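{- The subspace of $\textsf{ParSym}$ spanned by $\{\textsf{H}_\pi : \pi \text{ a planar partition diagram}\}$ is a Hopf subalgebra of $\textsf{ParSym}$: it contains $\textsf{H}_\varnothing$, is closed under the product, $\Delta$ maps it into its tensor square, and the antipode $S$ maps it into itself.
   Context: Partition diagrams of order $k$ are set partitions of $\{1,\ldots,k,1',\ldots,k'\}$, drawn with $1,\ldots,k$ in a top row and $1',\ldots,k'$ in a bottom row; $A_0=\{\varnothing\}$. A partition diagram is planar if it can be represented by a graph on these vertices whose connected components are the blocks, drawn with edges inside the rectangle spanned by the two rows, without edge crossings. For $\pi$ of order $k$, $\rho$ of order $l$: $\pi\otimes\rho$ has as blocks those of $\pi$ and those of $\rho$ shifted ($i\mapsto i+k$, $i'\mapsto(i+k)'$). A diagram is $\otimes$-irreducible if it is not $\rho^{(1)}\otimes\rho^{(2)}$ with both factors nonempty. For nonempty $\pi,\rho$ (orders $k,l$), $\pi\bullet\rho$ is obtained from $\pi\otimes\rho$ by merging the block containing $k'$ with the block containing $(k+1)'$; $\varnothing\bullet\rho=\rho$, $\pi\bullet\varnothing=\pi$. Over a field $\mathbbm{k}$, $\textsf{ParSym}$ has basis $\{\textsf{H}_\pi\}$ over all partition diagrams, product $\textsf{H}_\pi\textsf{H}_\rho=\textsf{H}_{\pi\otimes\rho}$, unit $\textsf{H}_\varnothing$ (free on $\textsf{H}_\pi$, $\pi$ nonempty $\otimes$-irreducible). $\Delta$ is the algebra morphism with $\Delta\textsf{H}_\varnothing=\textsf{H}_\varnothing\otimes\textsf{H}_\varnothing$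 and $\Delta\textsf{H}_\pi=\sum\textsf{H}_{G_1}\otimes\textsf{H}_{G_2}$ for nonempty $\otimes$-irreducible $\pi$, over ordered pairs $(G_1,G_2)$, each $\varnothing$ or $\otimes$-irreducible, with $G_1\bullet G_2=\pi$. $S$ is the linear antimorphism with $S(\textsf{H}_\varnothing)=\textsf{H}_\varnothing$ and $S(\textsf{H}_\pi)=\sum(-1)^\ell\textsf{H}_{\rho^{(1)}}\cdots\textsf{H}_{\rho^{(\ell)}}$ for nonempty $\otimes$-irreducible $\pi$, over tuples of nonempty diagrams with $\rho^{(1)}\bullet\cdots\bullet\rho^{(\ell)}=\pi$. -}

module Defs where

open import Level using (Level; _⊔_)
open import Data.Bool using (Bool; true; false; _∧_; _∨_; not; if_then_else_)
import Data.Bool.Properties as BoolP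
open import Data.Nat as ℕ using (ℕ; zero; suc; _∸_; _≡ᵇ_)
open import Data.Fin using (Fin)
import Data.Fin as Fin
open import Data.Product using (_×_; _,_; proj₁; proj₂; Σ-syntax; ∃-syntax)
open import Data.List using (List; []; _∷_; _++_; map; concatMap; upTo; take; drop;
  length; reverse; foldr; filter; null; lookup)
import Data.List.Properties as ListP
open import Data.List.Relation.Unary.All using (All)
open import Data.Maybe using (Maybe; just; nothing)
open import Relation.Nullary using (¬_; does)
open import Relation.Binary.PropositionalEquality using (_≡_)
open import Algebra.Bundles using (CommutativeRing)

record Field (c ℓ : Level) : Set (Level.suc (c ⊔ ℓ)) where
  field
    commutativeRing : CommutativeRing c ℓ
  open CommutativeRing commutativeRing public
  field
    0≉1     : ¬ (0# ≈ 1#)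
    inverse : ∀ x → ¬ (x ≈ 0#) → ∃[ y ] (x * y ≈ 1#)

-- A diagram of order k is a list of k columns; column i (1 ≤ i ≤ k) is the
-- pair (label of vertex i, label of vertex i').  The blocks of the set
-- partition are the classes of vertices carrying equal labels.  Different
-- labellings of the same set partition are identified by _≈D_ below.

Diag : Set
Diag = List (ℕ × ℕ)

order : Diag → ℕ
order = length

labels : Diag → List ℕ
labels π = map proj₁ π ++ map proj₂ π

pattern' : Diag → List (List Bool)
pattern' π = map (λ x → map (λ y → x ≡ᵇ y) (labels π)) (labels π)

_≈D?_ : Diag → Diag → Bool
π ≈D? ρ = (order π ≡ᵇ order ρ) ∧
          does (ListP.≡-dec (ListP.≡-dec BoolP._≟_) (pattern' π) (pattern' ρ))

∅D : Diag
∅D = []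

maxLabel : Diag → ℕ
maxLabel = foldr (λ p m → proj₁ p ℕ.⊔ proj₂ p ℕ.⊔ m) 0

-- π ⊗ ρ : ρ placed to the right of π, its labels made disjoint from π's
_⊗D_ : Diag → Diag → Diag
π ⊗D ρ = π ++ map (λ p → (suc (maxLabel π) ℕ.+ proj₁ p , suc (maxLabel π) ℕ.+ proj₂ p)) ρ

rename : ℕ → ℕ → Diag → Diag
rename a b = map (λ p → (r (proj₁ p) , r (proj₂ p)))
  where r : ℕ → ℕ
        r x = if x ≡ᵇ a then b else x

lastBot : Diag → ℕ
lastBot []            = 0
lastBot (p ∷ [])      = proj₂ p
lastBot (_ ∷ q ∷ π)   = lastBot (q ∷ π)

firstBot : Diag → ℕ
firstBot []      = 0
firstBot (p ∷ _) = proj₂ p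

-- π • ρ : π ⊗ ρ with the blocks of k' and (k+1)' merged; ∅ is a unit
_•D_ : Diag → Diag → Diag
[] •D ρ = ρ
(p ∷ π) •D [] = p ∷ π
(p ∷ π) •D (q ∷ ρ) =
  rename (suc (maxLabel (p ∷ π)) ℕ.+ firstBot (q ∷ ρ)) (lastBot (p ∷ π))
         ((p ∷ π) ⊗D (q ∷ ρ))

-- Enumeration of all partition diagrams of a given order, each set
-- partition exactly once (restricted growth strings on 1,…,k,1',…,k').

rgs : ℕ → ℕ → List (List ℕ)
rgs zero    m = [] ∷ []
rgs (suc n) m = concatMap (λ x → map (x ∷_) (rgs n (if x ≡ᵇ m then suc m else m))) (upTo (suc m))

zipL : List ℕ → List ℕ → Diag
zipL []       _        = []
zipL (_ ∷ _)  []       = []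
zipL (a ∷ as) (b ∷ bs) = (a , b) ∷ zipL as bs

diagrams : ℕ → List Diag
diagrams k = map (λ s → zipL (take k s) (drop k s)) (rgs (k ℕ.+ k) 0)

-- If π = ρ¹ ⊗ ρ² with ρ¹ of order j, then necessarily ρ¹ ≈ take j π and
-- ρ² ≈ drop j π, so π splits after column j iff π ≈ take j π ⊗ drop j π.

splitsAt : Diag → ℕ → Bool
splitsAt π j = (take j π ⊗D drop j π) ≈D? π

innerCuts : Diag → List ℕ
innerCuts π = map suc (upTo (order π ∸ 1))

anyB : List Bool → Bool
anyB = foldr _∨_ false

isIrr : Diag → Bool
isIrr π = not (null π) ∧ not (anyB (map (splitsAt π) (innerCuts π)))

firstCut : Diag → List ℕ → Maybe ℕ
firstCut π []       = nothing
firstCut π (j ∷ js) = if splitsAt π j then just j else firstCut π js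

factorsF : ℕ → Diag → List Diag
factorsF zero    π = []
factorsF (suc n) [] = []
factorsF (suc n) (p ∷ π) with firstCut (p ∷ π) (innerCuts (p ∷ π))
... | nothing = (p ∷ π) ∷ []
... | just j  = take j (p ∷ π) ∷ factorsF n (drop j (p ∷ π))

factors : Diag → List Diag
factors π = factorsF (order π) π

compsF : ℕ → ℕ → List (List ℕ)
compsF f       zero    = [] ∷ []
compsF zero    (suc n) = []
compsF (suc f) (suc n) = concatMap (λ a → map (suc a ∷_) (compsF f (n ∸ a))) (upTo (suc n))

compositions : ℕ → List (List ℕ)
compositions k = compsF k k

tuples : List ℕ → List (List Diag)
tuples []       = [] ∷ []
tuples (a ∷ as) = concatMap (λ d → map (d ∷_) (tuples as)) (diagrams a)

bullets : List Diag → Diag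
bullets = foldr _•D_ ∅D

tensors : List Diag → Diag
tensors = foldr _⊗D_ ∅D

-- Planarity: the partition is noncrossing for the cyclic boundary order
-- 1, …, k, k', …, 1' of the rectangle.

NonCrossing : List ℕ → Set
NonCrossing s = ∀ (a b c d : Fin (length s)) → a Fin.< b → b Fin.< c → c Fin.< d →
  lookup s a ≡ lookup s c → lookup s b ≡ lookup s d → lookup s a ≡ lookup s b

Planar : Diag → Set
Planar π = NonCrossing (map proj₁ π ++ reverse (map proj₂ π))

-- ParSym over a field 𝕜.  An element is a finite formal 𝕜-linear
-- combination of basis vectors H_π; two representations denote the same
-- element iff all coefficients agree.

module ParSym {c ℓ} (F : Field c ℓ) where
  open Field F

  Elt : Set c
  Elt = List (Carrier × Diag)

  -- elements of ParSym ⊗ ParSym, basis H_π ⊗ H_ρ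
  Elt2 : Set c
  Elt2 = List (Carrier × Diag × Diag)

  coeff : Elt → Diag → Carrier
  coeff x π = foldr (λ t acc → if proj₂ t ≈D? π then proj₁ t + acc else acc) 0# x

  coeff2 : Elt2 → Diag → Diag → Carrier
  coeff2 x π ρ = foldr (λ t acc → if (proj₁ (proj₂ t) ≈D? π) ∧ (proj₂ (proj₂ t) ≈D? ρ)
                                   then proj₁ t + acc else acc) 0# x

  H : Diag → Elt
  H π = (1# , π) ∷ []

  one : Elt
  one = H ∅D

  mul : Elt → Elt → Elt
  mul x y = concatMap (λ s → map (λ t → (proj₁ s * proj₁ t , proj₂ s ⊗D proj₂ t)) y) x

  prodL : List Elt → Elt
  prodL = foldr mul one

  one2 : Elt2
  one2 = (1# , ∅D , ∅D) ∷ []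

  mul2 : Elt2 → Elt2 → Elt2
  mul2 x y = concatMap (λ s → map (λ t → (proj₁ s * proj₁ t ,
      proj₁ (proj₂ s) ⊗D proj₁ (proj₂ t) , proj₂ (proj₂ s) ⊗D proj₂ (proj₂ t))) y) x

  prodL2 : List Elt2 → Elt2
  prodL2 = foldr mul2 one2

  scale : Carrier → Elt → Elt
  scale a = map (λ t → (a * proj₁ t , proj₂ t))

  scale2 : Carrier → Elt2 → Elt2
  scale2 a = map (λ t → (a * proj₁ t , proj₂ t))

  okG : Diag → Bool
  okG G = null G ∨ isIrr G

  -- Δ H_π for π nonempty ⊗-irreducible: sum over (G₁,G₂), each ∅ or
  -- ⊗-irreducible, with G₁ • G₂ = π  (orders of G₁, G₂ add up to order π)
  ΔIrr : Diag → Elt2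
  ΔIrr π = concatMap (λ a → concatMap (λ G₁ → concatMap (λ G₂ →
             if okG G₁ ∧ okG G₂ ∧ ((G₁ •D G₂) ≈D? π)
             then (1# , G₁ , G₂) ∷ [] else [])
           (diagrams (order π ∸ a))) (diagrams a)) (upTo (suc (order π)))

  -- Δ is the algebra morphism extending ΔIrr
  ΔH : Diag → Elt2
  ΔH π = prodL2 (map ΔIrr (factors π))

  Δ : Elt → Elt2
  Δ = concatMap (λ t → scale2 (proj₁ t) (ΔH (proj₂ t)))

  sign : ℕ → Carrier
  sign zero    = 1#
  sign (suc n) = - sign n

  -- S H_π for π nonempty ⊗-irreducible: sum over tuples of nonempty
  -- diagrams ρ¹,…,ρˡ with ρ¹ • ⋯ • ρˡ = π of (-1)ˡ H_{ρ¹} ⋯ H_{ρˡ}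
  SIrr : Diag → Elt
  SIrr π = concatMap (λ comp → concatMap (λ tup →
             if bullets tup ≈D? π then (sign (length comp) , tensors tup) ∷ [] else [])
           (tuples comp)) (compositions (order π))

  -- S is the linear antimorphism extending SIrr
  SH : Diag → Elt
  SH π = prodL (reverse (map SIrr (factors π)))

  S : Elt → Elt
  S = concatMap (λ t → scale (proj₁ t) (SH (proj₂ t)))

  InPlanarSpan : Elt → Set (c ⊔ ℓ)
  InPlanarSpan x = ∃[ y ] (All (λ t → Planar (proj₂ t)) y ×
                           (∀ π → coeff x π ≈ coeff y π))

  InPlanarSpan2 : Elt2 → Set (c ⊔ ℓ)
  InPlanarSpan2 x = ∃[ y ] (All (λ t → Planar (proj₁ (proj₂ t)) × Planar (proj₂ (proj₂ t))) y ×
                            (∀ π ρ → coeff2 x π ρ ≈ coeff2 y π ρ))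

{-# OPTIONS --safe #-}
-- An element lies in the planar span iff some formal combination representing it uses planar
-- diagrams only.  On such a representative the formulas for product, coproduct and antipode
-- produce planar diagrams only, because planarity is a property of the boundary word of a
-- diagram (it has no subsequence x y x y with x ≢ y): the boundary word of π ⊗ ρ is that of π
-- with a shifted copy of that of ρ inserted, and the boundary words of the ⊗-factors of π and
-- of the two sides of π • ρ are, up to an injective relabelling, subsequences of the boundary
-- word of the whole.  These formulas also respect ≈D, since ≈D-equivalent diagrams are
-- relabellings of each other and take, drop and ⊗ commute with relabelling.
module Submission where

open import Defs
open import Level using (Level)
open import Algebra.Bundles using (CommutativeRing)
open import Data.Product using (_×_; _,_)

module PlanarDiagrams where

  open import Function using (_∘_)
  open import Data.Bool using (Bool; true; _∧_; if_then_else_; T)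
  import Data.Bool.Properties as Bool
  open import Data.Empty using (⊥; ⊥-elim)
  open import Data.Fin using (Fin; zero; suc; toℕ)
  open import Data.Nat as ℕ using (ℕ; zero; suc; _+_; _∸_; _≤_; _<_; _≡ᵇ_; _≤ᵇ_; _⊔_; z≤n; z<s; s<s)
  open import Data.Nat.Properties
    using (_≟_; _≤?_; ≡ᵇ⇒≡; ≡⇒≡ᵇ; ≤-reflexive; ≤-trans; m≤m+n; m≤m⊔n; m≤n⊔m; 1+n≰n; m+n∸m≡n; +-cancelˡ-≡)
  open import Data.Product using (proj₁; proj₂; ∃-syntax)
  import Data.Product as Product
  open import Data.Sum using (inj₁; inj₂)
  open import Data.Maybe using (just; nothing)
  open import Data.List using (List; []; _∷_; _++_; map; take; drop; length; reverse; lookup; upTo)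
  open import Data.List.Properties
    using (map-++; map-∘; map-cong; map-cong-local; map-id-local; length-map; reverse-++; reverse-map;
           ++-assoc; ++-identityʳ; take++drop≡id; take-map; drop-map; ∷-injectiveˡ; ∷-injectiveʳ)
  import Data.List.Properties as List
  open import Data.List.Membership.Propositional using (_∈_; _∉_)
  open import Data.List.Membership.Propositional.Properties using (∈-map⁻; ∈-++⁻; ∈-++⁺ˡ; ∈-++⁺ʳ)
  open import Data.List.Membership.DecPropositional _≟_ using (_∈?_)
  open import Data.List.Relation.Unary.Any using (here; there)
  import Data.List.Relation.Unary.Any as Any
  import Data.List.Relation.Unary.Any.Properties as Any
  open import Data.List.Relation.Unary.All using (All; []; _∷_)
  import Data.List.Relation.Unary.All as All
  open import Data.List.Relation.Binary.Pointwise using (Pointwise; []; _∷_; ≡⇒Pointwise-≡)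
  import Data.List.Relation.Binary.Pointwise as Pointwise
  open import Data.List.Relation.Binary.Sublist.Propositional using (_⊆_; []; _∷_; _∷ʳ_; ⊆-refl; ⊆-trans)
  open import Data.List.Relation.Binary.Sublist.Propositional.Properties
    using (Any-resp-⊆; ∷ˡ⁻; ++⁺; ++⁺ˡ; ++⁺ʳ; drop⁺-≥; []⊆-universal)
  import Data.List.Relation.Binary.Sublist.Propositional.Properties as Sublist
  open import Relation.Nullary using (yes; no; does)
  open import Relation.Nullary.Decidable using (dec-true; dec-false; does-⇔)
  open import Relation.Binary.PropositionalEquality
    using (_≡_; _≢_; refl; sym; trans; cong; cong₂; subst; subst₂; module ≡-Reasoning)
  open import Function.Bundles using (mk⇔)

  module _ {a} {A : Set a} where

    position : {xs ys : List A} → xs ⊆ ys → Fin (length xs) → Fin (length ys)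
    position (y ∷ʳ τ) i       = suc (position τ i)
    position (_ ∷ τ)  zero    = zero
    position (_ ∷ τ)  (suc i) = suc (position τ i)

    lookup-position : {xs ys : List A} (τ : xs ⊆ ys) (i : Fin (length xs)) →
                      lookup ys (position τ i) ≡ lookup xs i
    lookup-position (y ∷ʳ τ)   i       = lookup-position τ i
    lookup-position (refl ∷ τ) zero    = refl
    lookup-position (_ ∷ τ)    (suc i) = lookup-position τ i

    position-< : {xs ys : List A} (τ : xs ⊆ ys) {i j : Fin (length xs)} →
                 toℕ i < toℕ j → toℕ (position τ i) < toℕ (position τ j)
    position-< (y ∷ʳ τ) i<j                       = s<s (position-< τ i<j)
    position-< (_ ∷ τ)  {zero}  {suc j} _         = z<s
    position-< (_ ∷ τ)  {suc i} {suc j} (s<s i<j) = s<s (position-< τ i<j)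

    lookup∷⊆drop : {xs ys : List A} (i : Fin (length ys)) →
                   xs ⊆ drop (suc (toℕ i)) ys → lookup ys i ∷ xs ⊆ drop (toℕ i) ys
    lookup∷⊆drop {ys = _ ∷ _} zero    τ = refl ∷ τ
    lookup∷⊆drop {ys = _ ∷ ys} (suc i) τ = lookup∷⊆drop {ys = ys} i τ

    ⊆-++-outer : ∀ ws {ys zs : List A} → ws ++ zs ⊆ ws ++ ys ++ zs
    ⊆-++-outer ws {ys} = ++⁺ (⊆-refl {x = ws}) (++⁺ˡ ys ⊆-refl)

    ⊆-++-inner : ∀ ws {ys zs : List A} → ys ⊆ ws ++ ys ++ zs
    ⊆-++-inner ws {zs = zs} = ++⁺ˡ ws (++⁺ʳ zs ⊆-refl)

    ⊆-++-avoid : ∀ ws {zs ys xs : List A} → All (_∉ zs) xs → xs ⊆ ws ++ zs ++ ys → xs ⊆ ws ++ ys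
    ⊆-++-avoid (w ∷ ws) ∉zs       (.w ∷ʳ τ) = w ∷ʳ ⊆-++-avoid ws ∉zs τ
    ⊆-++-avoid (w ∷ ws) (_ ∷ ∉zs) (x≡w ∷ τ) = x≡w ∷ ⊆-++-avoid ws ∉zs τ
    ⊆-++-avoid [] {[]}     _         τ         = τ
    ⊆-++-avoid [] {z ∷ zs} ∉zs       (.z ∷ʳ τ) = ⊆-++-avoid [] {zs} (All.map (_∘ there) ∉zs) τ
    ⊆-++-avoid [] {z ∷ zs} (x∉ ∷ _)  (x≡z ∷ τ) = ⊥-elim (x∉ (here x≡z))

    ⊆-++-avoidʳ : ∀ ys {zs xs : List A} → All (_∉ zs) xs → xs ⊆ ys ++ zs → xs ⊆ ys
    ⊆-++-avoidʳ ys {zs} ∉zs τ =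
      subst (_ ⊆_) (++-identityʳ ys) (⊆-++-avoid ys ∉zs (subst (λ l → _ ⊆ ys ++ l) (sym (++-identityʳ zs)) τ))

    ⊆-++-skipˡ : ∀ ws {ys xs : List A} {x} → x ∉ ws → x ∷ xs ⊆ ws ++ ys → x ∷ xs ⊆ ys
    ⊆-++-skipˡ []       _  τ         = τ
    ⊆-++-skipˡ (w ∷ ws) x∉ (.w ∷ʳ τ) = ⊆-++-skipˡ ws (x∉ ∘ there) τ
    ⊆-++-skipˡ (w ∷ ws) x∉ (x≡w ∷ τ) = ⊥-elim (x∉ (here x≡w))

    ∷∷⊆-++⇒∈ : ∀ ws {zs xs : List A} {x y} → y ∉ zs → x ∷ y ∷ xs ⊆ ws ++ zs → x ∈ ws
    ∷∷⊆-++⇒∈ []       y∉ τ         = ⊥-elim (y∉ (Any-resp-⊆ (∷ˡ⁻ τ) (here refl)))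
    ∷∷⊆-++⇒∈ (w ∷ ws) y∉ (.w ∷ʳ τ) = there (∷∷⊆-++⇒∈ ws y∉ τ)
    ∷∷⊆-++⇒∈ (w ∷ ws) y∉ (x≡w ∷ τ) = here x≡w

    between-∈ : ∀ ws {ys zs xs : List A} {x y z} → x ∉ ws → z ∉ zs →
                x ∷ y ∷ z ∷ xs ⊆ ws ++ ys ++ zs → y ∈ ys
    between-∈ ws {ys} x∉ z∉ τ = ∷∷⊆-++⇒∈ ys z∉ (∷ˡ⁻ (⊆-++-skipˡ ws x∉ τ))

  -- Non-crossing sequences

  NonCrossing⊆ : List ℕ → Set
  NonCrossing⊆ s = ∀ {x y} → x ∷ y ∷ x ∷ y ∷ [] ⊆ s → x ≡ y

  NonCrossing⇒NonCrossing⊆ : ∀ {s} → NonCrossing s → NonCrossing⊆ s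
  NonCrossing⇒NonCrossing⊆ {s} nc {x} {y} τ = begin
    x                        ≡⟨ sym (at i₀) ⟩
    lookup s (position τ i₀) ≡⟨ nc (position τ i₀) (position τ i₁) (position τ i₂) (position τ i₃)
                                (position-< τ {i₀} {i₁} z<s) (position-< τ {i₁} {i₂} (s<s z<s))
                                (position-< τ {i₂} {i₃} (s<s (s<s z<s)))
                                (trans (at i₀) (sym (at i₂))) (trans (at i₁) (sym (at i₃))) ⟩
    lookup s (position τ i₁) ≡⟨ at i₁ ⟩
    y                        ∎
    where
    open ≡-Reasoning
    i₀ i₁ i₂ i₃ : Fin 4
    i₀ = zero; i₁ = suc zero; i₂ = suc (suc zero); i₃ = suc (suc (suc zero))
    at = lookup-position τ

  NonCrossing⊆⇒NonCrossing : ∀ {s} → NonCrossing⊆ s → NonCrossing s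
  NonCrossing⊆⇒NonCrossing {s} nc a b c d a<b b<c c<d a~c b~d =
    nc (subst₂ (λ u v → lookup s a ∷ lookup s b ∷ u ∷ v ∷ [] ⊆ s) (sym a~c) (sym b~d) abcd⊆s)
    where
    entry : ∀ {xs n} (i : Fin (length s)) → toℕ i < n → xs ⊆ drop n s → lookup s i ∷ xs ⊆ drop (toℕ i) s
    entry i i<n τ = lookup∷⊆drop {ys = s} i (⊆-trans τ (drop⁺-≥ {xs = s} i<n))
    abcd⊆s : lookup s a ∷ lookup s b ∷ lookup s c ∷ lookup s d ∷ [] ⊆ s
    abcd⊆s = ⊆-trans (entry a a<b (entry b b<c (entry c c<d (lookup∷⊆drop {ys = s} d ([]⊆-universal _)))))
                     (drop⁺-≥ {m = toℕ a} {xs = s} z≤n)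

  NonCrossing⊆-anti : ∀ {s t} → s ⊆ t → NonCrossing⊆ t → NonCrossing⊆ s
  NonCrossing⊆-anti σ nc τ = nc (⊆-trans τ σ)

  NonCrossing⊆-map⁻ : ∀ {f : ℕ → ℕ} {s} → (∀ {x y} → x ∈ s → y ∈ s → f x ≡ f y → x ≡ y) →
                      NonCrossing⊆ (map f s) → NonCrossing⊆ s
  NonCrossing⊆-map⁻ {f} injective nc τ =
    injective (Any-resp-⊆ τ (here refl)) (Any-resp-⊆ τ (there (here refl))) (nc (Sublist.map⁺ f τ))

  map-id-local⁻ : ∀ {a} {A : Set a} {f : A → A} {xs} → map f xs ≡ xs → All (λ x → f x ≡ x) xs
  map-id-local⁻ {xs = []}     _ = []
  map-id-local⁻ {xs = x ∷ xs} e = ∷-injectiveˡ e ∷ map-id-local⁻ (∷-injectiveʳ e)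

  NonCrossing⊆-map⁺ : ∀ {f g : ℕ → ℕ} {s} → (∀ {x} → x ∈ s → g (f x) ≡ x) →
                      NonCrossing⊆ s → NonCrossing⊆ (map f s)
  NonCrossing⊆-map⁺ {f} {g} {s} inverse nc = NonCrossing⊆-map⁻ injective (subst NonCrossing⊆ (sym gfs≡s) nc)
    where
    gfs≡s : map g (map f s) ≡ s
    gfs≡s = trans (sym (map-∘ s)) (map-id-local (All.tabulate inverse))
    injective : ∀ {u v} → u ∈ map f s → v ∈ map f s → g u ≡ g v → u ≡ v
    injective u∈ v∈ gu≡gv with ∈-map⁻ f u∈ | ∈-map⁻ f v∈
    ... | x , x∈ , refl | y , y∈ , refl = cong f (trans (sym (inverse x∈)) (trans gu≡gv (inverse y∈)))

  -- The entries x y x y come either all from ys or all from ws ++ zs: if only x occurs in ys,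
  -- the y between its two occurrences lies in ys as well by between-∈ (and symmetrically).
  NonCrossing⊆-insert : ∀ ws ys zs → (∀ {x} → x ∈ ys → x ∈ ws ++ zs → ⊥) →
                        NonCrossing⊆ (ws ++ zs) → NonCrossing⊆ ys → NonCrossing⊆ (ws ++ ys ++ zs)
  NonCrossing⊆-insert ws ys zs disjoint ncOuter ncInner {x} {y} τ with x ∈? ys | y ∈? ys
  ... | yes x∈ | yes y∈ =
    ncInner (⊆-++-avoidʳ ys (outside zs (∈-++⁺ʳ ws)) (⊆-++-avoid [] (outside ws ∈-++⁺ˡ) τ))
    where
    outside : ∀ vs → (∀ {v} → v ∈ vs → v ∈ ws ++ zs) → All (_∉ vs) (x ∷ y ∷ x ∷ y ∷ [])
    outside vs into = let x∉ = disjoint x∈ ∘ into; y∉ = disjoint y∈ ∘ into in x∉ ∷ y∉ ∷ x∉ ∷ y∉ ∷ []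
  ... | yes x∈ | no  y∉ = ⊥-elim (y∉ (between-∈ ws (disjoint x∈ ∘ ∈-++⁺ˡ) (disjoint x∈ ∘ ∈-++⁺ʳ ws) τ))
  ... | no  x∉ | yes y∈ = ⊥-elim (x∉ (between-∈ ws (disjoint y∈ ∘ ∈-++⁺ˡ) (disjoint y∈ ∘ ∈-++⁺ʳ ws) (∷ˡ⁻ τ)))
  ... | no  x∉ | no  y∉ = ncOuter (⊆-++-avoid ws (x∉ ∷ y∉ ∷ x∉ ∷ y∉ ∷ []) τ)

  -- Planar π unfolds to NonCrossing (boundary π).
  boundary : Diag → List ℕ
  boundary π = map proj₁ π ++ reverse (map proj₂ π)

  relabel : (ℕ → ℕ) → Diag → Diag
  relabel f = map (λ p → f (proj₁ p) , f (proj₂ p))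

  relabel-∘ : ∀ {f g} π → relabel g (relabel f π) ≡ relabel (g ∘ f) π
  relabel-∘ π = sym (map-∘ π)

  relabel-cong : ∀ {f g} → (∀ x → f x ≡ g x) → ∀ π → relabel f π ≡ relabel g π
  relabel-cong f≗g = map-cong (λ p → cong₂ _,_ (f≗g (proj₁ p)) (f≗g (proj₂ p)))

  module _ {f : ℕ → ℕ} (π : Diag) where

    tops-relabel : map proj₁ (relabel f π) ≡ map f (map proj₁ π)
    tops-relabel = trans (sym (map-∘ π)) (map-∘ π)

    bottoms-relabel : map proj₂ (relabel f π) ≡ map f (map proj₂ π)
    bottoms-relabel = trans (sym (map-∘ π)) (map-∘ π)

    labels-relabel : labels (relabel f π) ≡ map f (labels π)
    labels-relabel = trans (cong₂ _++_ tops-relabel bottoms-relabel) (sym (map-++ f (map proj₁ π) _))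

    boundary-relabel : boundary (relabel f π) ≡ map f (boundary π)
    boundary-relabel =
      trans (cong₂ _++_ tops-relabel (trans (cong reverse bottoms-relabel) (sym (reverse-map f (map proj₂ π)))))
            (sym (map-++ f (map proj₁ π) _))

  boundary-++ : ∀ π ρ → boundary (π ++ ρ) ≡ map proj₁ π ++ boundary ρ ++ reverse (map proj₂ π)
  boundary-++ π ρ = begin
    map proj₁ (π ++ ρ) ++ reverse (map proj₂ (π ++ ρ))
      ≡⟨ cong₂ (λ u v → u ++ reverse v) (map-++ proj₁ π ρ) (map-++ proj₂ π ρ) ⟩
    (map proj₁ π ++ map proj₁ ρ) ++ reverse (map proj₂ π ++ map proj₂ ρ)
      ≡⟨ cong ((map proj₁ π ++ map proj₁ ρ) ++_) (reverse-++ (map proj₂ π) (map proj₂ ρ)) ⟩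
    (map proj₁ π ++ map proj₁ ρ) ++ reverse (map proj₂ ρ) ++ reverse (map proj₂ π)
      ≡⟨ ++-assoc (map proj₁ π) _ _ ⟩
    map proj₁ π ++ map proj₁ ρ ++ reverse (map proj₂ ρ) ++ reverse (map proj₂ π)
      ≡⟨ cong (map proj₁ π ++_) (sym (++-assoc (map proj₁ ρ) _ _)) ⟩
    map proj₁ π ++ boundary ρ ++ reverse (map proj₂ π) ∎
    where open ≡-Reasoning

  boundary-⊗ : ∀ π ρ → boundary (π ⊗D ρ) ≡
               map proj₁ π ++ map (suc (maxLabel π) +_) (boundary ρ) ++ reverse (map proj₂ π)
  boundary-⊗ π ρ = trans (boundary-++ π _) (cong (λ u → map proj₁ π ++ u ++ _) (boundary-relabel ρ))

  boundary-take-drop : ∀ j π → boundary π ≡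
                       map proj₁ (take j π) ++ boundary (drop j π) ++ reverse (map proj₂ (take j π))
  boundary-take-drop j π = trans (cong boundary (sym (take++drop≡id j π))) (boundary-++ (take j π) _)

  ∈-boundary⇒∈-labels : ∀ {x} π → x ∈ boundary π → x ∈ labels π
  ∈-boundary⇒∈-labels π x∈ with ∈-++⁻ (map proj₁ π) x∈
  ... | inj₁ x∈tops    = ∈-++⁺ˡ x∈tops
  ... | inj₂ x∈bottoms = ∈-++⁺ʳ (map proj₁ π) (Any.reverse⁻ x∈bottoms)

  column-≤-maxLabel : ∀ {p π} → p ∈ π → proj₁ p ≤ maxLabel π × proj₂ p ≤ maxLabel π
  column-≤-maxLabel {π = (a , b) ∷ π} (here refl) =
    ≤-trans (m≤m⊔n a b) (m≤m⊔n _ (maxLabel π)) , ≤-trans (m≤n⊔m a b) (m≤m⊔n _ (maxLabel π))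
  column-≤-maxLabel {π = q ∷ π} (there p∈) = Product.map weaken weaken (column-≤-maxLabel p∈)
    where
    weaken : ∀ {x} → x ≤ maxLabel π → x ≤ maxLabel (q ∷ π)
    weaken le = ≤-trans le (m≤n⊔m (proj₁ q ⊔ proj₂ q) (maxLabel π))

  labels-≤-maxLabel : ∀ {x} π → x ∈ labels π → x ≤ maxLabel π
  labels-≤-maxLabel π x∈ with ∈-++⁻ (map proj₁ π) x∈
  ... | inj₁ x∈tops with ∈-map⁻ proj₁ x∈tops
  ...   | _ , p∈ , refl = proj₁ (column-≤-maxLabel p∈)
  labels-≤-maxLabel π x∈ | inj₂ x∈bottoms with ∈-map⁻ proj₂ x∈bottoms
  ...   | _ , p∈ , refl = proj₂ (column-≤-maxLabel p∈)

  relabel-leftInverse : ∀ {f g x} π → relabel g (relabel f π) ≡ π → x ∈ labels π → g (f x) ≡ x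
  relabel-leftInverse {f} {g} π gfπ≡π = All.lookup (map-id-local⁻ (begin
    map (g ∘ f) (labels π)             ≡⟨ map-∘ (labels π) ⟩
    map g (map f (labels π))           ≡⟨ cong (map g) (labels-relabel π) ⟨
    map g (labels (relabel f π))       ≡⟨ labels-relabel (relabel f π) ⟨
    labels (relabel g (relabel f π))   ≡⟨ cong labels gfπ≡π ⟩
    labels π                           ∎))
    where open ≡-Reasoning

  -- Planarity

  Planar-∅ : Planar ∅D
  Planar-∅ ()

  Planar-relabel : ∀ {f g π ρ} → relabel f π ≡ ρ → relabel g ρ ≡ π → Planar π → Planar ρ
  Planar-relabel {g = g} {π = π} refl gfπ≡π planar =
    NonCrossing⊆⇒NonCrossing (subst NonCrossing⊆ (sym (boundary-relabel π))
      (NonCrossing⊆-map⁺ {g = g} (relabel-leftInverse π gfπ≡π ∘ ∈-boundary⇒∈-labels π)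
        (NonCrossing⇒NonCrossing⊆ planar)))

  Planar-⊗⁺ : ∀ π ρ → Planar π → Planar ρ → Planar (π ⊗D ρ)
  Planar-⊗⁺ π ρ planarπ planarρ =
    NonCrossing⊆⇒NonCrossing (subst NonCrossing⊆ (sym (boundary-⊗ π ρ))
      (NonCrossing⊆-insert (map proj₁ π) (map (m +_) (boundary ρ)) (reverse (map proj₂ π)) disjoint
        (NonCrossing⇒NonCrossing⊆ planarπ)
        (NonCrossing⊆-map⁺ {g = _∸ m} (λ {x} _ → m+n∸m≡n m x) (NonCrossing⇒NonCrossing⊆ planarρ))))
    where
    m = suc (maxLabel π)
    disjoint : ∀ {x} → x ∈ map (m +_) (boundary ρ) → x ∈ boundary π → ⊥
    disjoint x∈ρ x∈π with ∈-map⁻ (m +_) x∈ρ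
    ... | y , _ , refl = 1+n≰n (≤-trans (m≤m+n m y) (labels-≤-maxLabel π (∈-boundary⇒∈-labels π x∈π)))

  Planar-take⁺ : ∀ j {π} → Planar π → Planar (take j π)
  Planar-take⁺ j {π} planar =
    NonCrossing⊆⇒NonCrossing (NonCrossing⊆-anti (⊆-++-outer (map proj₁ (take j π)))
      (subst NonCrossing⊆ (boundary-take-drop j π) (NonCrossing⇒NonCrossing⊆ planar)))

  Planar-drop⁺ : ∀ j {π} → Planar π → Planar (drop j π)
  Planar-drop⁺ j {π} planar =
    NonCrossing⊆⇒NonCrossing (NonCrossing⊆-anti (⊆-++-inner (map proj₁ (take j π)) {zs = reverse (map proj₂ (take j π))})
      (subst NonCrossing⊆ (boundary-take-drop j π) (NonCrossing⇒NonCrossing⊆ planar)))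

  -- rename a b is relabel (renameLabel a b) by definition.
  renameLabel : ℕ → ℕ → ℕ → ℕ
  renameLabel a b x = if x ≡ᵇ a then b else x

  module _ {a b x : ℕ} where

    renameLabel-≡ : x ≡ a → renameLabel a b x ≡ b
    renameLabel-≡ x≡a = cong (if_then b else x) (dec-true (x ≟ a) x≡a)

    renameLabel-≢ : x ≢ a → renameLabel a b x ≡ x
    renameLabel-≢ x≢a = cong (if_then b else x) (dec-false (x ≟ a) x≢a)

  renameLabel-injective : ∀ {a b x y} → x ≢ b → y ≢ b → renameLabel a b x ≡ renameLabel a b y → x ≡ y
  renameLabel-injective {a} {b} {x} {y} x≢b y≢b e with x ≟ a | y ≟ a
  ... | yes x≡a | yes y≡a = trans x≡a (sym y≡a)
  ... | yes x≡a | no  y≢a = ⊥-elim (y≢b (sym (trans (sym (renameLabel-≡ x≡a)) (trans e (renameLabel-≢ y≢a)))))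
  ... | no  x≢a | yes y≡a = ⊥-elim (x≢b (trans (sym (renameLabel-≢ x≢a)) (trans e (renameLabel-≡ y≡a))))
  ... | no  x≢a | no  y≢a = trans (sym (renameLabel-≢ x≢a)) (trans e (renameLabel-≢ y≢a))

  lastBot-≤-maxLabel : ∀ π → lastBot π ≤ maxLabel π
  lastBot-≤-maxLabel []          = z≤n
  lastBot-≤-maxLabel (p ∷ [])    = ≤-trans (m≤n⊔m (proj₁ p) (proj₂ p)) (m≤m⊔n _ 0)
  lastBot-≤-maxLabel (p ∷ q ∷ π) = ≤-trans (lastBot-≤-maxLabel (q ∷ π)) (m≤n⊔m (proj₁ p ⊔ proj₂ p) _)

  -- π • ρ relabels the boundary of π ⊗ ρ by a map that fixes the labels of π and is injective
  -- on the shifted labels of ρ.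
  Planar-•⁻ : ∀ π ρ → Planar (π •D ρ) → Planar π × Planar ρ
  Planar-•⁻ []      ρ       planar = Planar-∅ , planar
  Planar-•⁻ (p ∷ π) []      planar = planar , Planar-∅
  Planar-•⁻ (p ∷ π) (q ∷ ρ) planar =
    NonCrossing⊆⇒NonCrossing (subst NonCrossing⊆ (map-id-local (All.tabulate r-fixes))
      (NonCrossing⊆-anti (Sublist.map⁺ r (⊆-++-outer (map proj₁ (p ∷ π)))) nc)) ,
    NonCrossing⊆⇒NonCrossing (NonCrossing⊆-map⁻ (λ _ _ → +-cancelˡ-≡ m _ _)
      (NonCrossing⊆-map⁻ r-injective (NonCrossing⊆-anti (Sublist.map⁺ r (⊆-++-inner (map proj₁ (p ∷ π)))) nc)))
    where
    m = suc (maxLabel (p ∷ π))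
    r = renameLabel (m + proj₂ q) (lastBot (p ∷ π))
    nc : NonCrossing⊆ (map r (map proj₁ (p ∷ π) ++ map (m +_) (boundary (q ∷ ρ)) ++ reverse (map proj₂ (p ∷ π))))
    nc = subst NonCrossing⊆
           (trans (boundary-relabel ((p ∷ π) ⊗D (q ∷ ρ))) (cong (map r) (boundary-⊗ (p ∷ π) (q ∷ ρ))))
           (NonCrossing⇒NonCrossing⊆ planar)
    small : ∀ {x} → x ∈ boundary (p ∷ π) → x ≤ maxLabel (p ∷ π)
    small = labels-≤-maxLabel (p ∷ π) ∘ ∈-boundary⇒∈-labels (p ∷ π)
    r-fixes : ∀ {x} → x ∈ boundary (p ∷ π) → r x ≡ x
    r-fixes x∈ = renameLabel-≢ λ x≡ →
      1+n≰n (≤-trans (≤-trans (m≤m+n m (proj₂ q)) (≤-reflexive (sym x≡))) (small x∈))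
    large : ∀ {x} → x ∈ map (m +_) (boundary (q ∷ ρ)) → x ≢ lastBot (p ∷ π)
    large x∈ x≡ with ∈-map⁻ (m +_) x∈
    ... | y , _ , refl = 1+n≰n (≤-trans (≤-trans (m≤m+n m y) (≤-reflexive x≡)) (lastBot-≤-maxLabel (p ∷ π)))
    r-injective : ∀ {x y} → x ∈ map (m +_) (boundary (q ∷ ρ)) → y ∈ map (m +_) (boundary (q ∷ ρ)) →
                  r x ≡ r y → x ≡ y
    r-injective x∈ y∈ = renameLabel-injective (large x∈) (large y∈)

  Planar-bullets⁻ : ∀ ρs → Planar (bullets ρs) → All Planar ρs
  Planar-bullets⁻ []       _      = []
  Planar-bullets⁻ (ρ ∷ ρs) planar = let planarρ , planarρs = Planar-•⁻ ρ (bullets ρs) planar in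
                                    planarρ ∷ Planar-bullets⁻ ρs planarρs

  Planar-tensors⁺ : ∀ ρs → All Planar ρs → Planar (tensors ρs)
  Planar-tensors⁺ []       []                 = Planar-∅
  Planar-tensors⁺ (ρ ∷ ρs) (planar ∷ planars) =
    Planar-⊗⁺ ρ (tensors ρs) planar (Planar-tensors⁺ ρs planars)

  Key : Set
  Key = ℕ × List (List Bool)

  key : Diag → Key
  key π = order π , pattern' π

  -- π ≈D? ρ is sameKey (key π) (key ρ) by definition.
  sameKey : Key → Key → Bool
  sameKey (n , P) (m , Q) = (n ≡ᵇ m) ∧ does (List.≡-dec (List.≡-dec Bool._≟_) P Q)

  ≈D?-refl : ∀ π → (π ≈D? π) ≡ true
  ≈D?-refl π = cong₂ _∧_ (dec-true (order π ≟ order π) refl)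
                         (dec-true (List.≡-dec (List.≡-dec Bool._≟_) (pattern' π) (pattern' π)) refl)

  sameKey-sound : ∀ K L → sameKey K L ≡ true → K ≡ L
  sameKey-sound (n , P) (m , Q) e with n ≡ᵇ m in n≡m | List.≡-dec (List.≡-dec Bool._≟_) P Q
  ... | true | yes P≡Q = cong₂ _,_ (≡ᵇ⇒≡ n m (subst T (sym n≡m) _)) P≡Q

  ≈D?⇒key≡ : ∀ π ρ → (π ≈D? ρ) ≡ true → key π ≡ key ρ
  ≈D?⇒key≡ π ρ = sameKey-sound (key π) (key ρ)

  ≈D?-congˡ : ∀ π π' σ → key π ≡ key π' → (π ≈D? σ) ≡ (π' ≈D? σ)
  ≈D?-congˡ π π' σ = cong (λ K → sameKey K (key σ))

  ≈D?-congʳ : ∀ π σ σ' → key σ ≡ key σ' → (π ≈D? σ) ≡ (π ≈D? σ')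
  ≈D?-congʳ π σ σ' = cong (sameKey (key π))

  -- pattern' π is eqPattern (labels π) by definition.
  eqPattern : List ℕ → List (List Bool)
  eqPattern L = map (λ x → map (λ y → x ≡ᵇ y) L) L

  eqPattern-map : ∀ {f g : ℕ → ℕ} {L} → (∀ {x} → x ∈ L → g (f x) ≡ x) → eqPattern (map f L) ≡ eqPattern L
  eqPattern-map {f} {g} {L} inverse = begin
    map (λ u → map (u ≡ᵇ_) (map f L)) (map f L)   ≡⟨ sym (map-∘ L) ⟩
    map (λ x → map (f x ≡ᵇ_) (map f L)) L         ≡⟨ map-cong (λ x → sym (map-∘ L)) L ⟩
    map (λ x → map (λ y → f x ≡ᵇ f y) L) L        ≡⟨ map-cong-local (All.tabulate λ x∈ →
                                                       map-cong-local (All.tabulate λ y∈ → ≡ᵇ-injective x∈ y∈)) ⟩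
    map (λ x → map (x ≡ᵇ_) L) L                   ∎
    where
    open ≡-Reasoning
    ≡ᵇ-injective : ∀ {x y} → x ∈ L → y ∈ L → (f x ≡ᵇ f y) ≡ (x ≡ᵇ y)
    ≡ᵇ-injective {x} {y} x∈ y∈ =
      does-⇔ (mk⇔ (λ fx≡fy → trans (sym (inverse x∈)) (trans (cong g fx≡fy) (inverse y∈))) (cong f))
             (f x ≟ f y) (x ≟ y)

  follow : List ℕ → List ℕ → ℕ → ℕ
  follow (a ∷ as) (b ∷ bs) x = if x ≡ᵇ a then b else follow as bs x
  follow _        _        x = x

  follow-correct : ∀ {x x' as bs} → Pointwise (λ y y' → (x ≡ᵇ y) ≡ (x' ≡ᵇ y')) as bs → x ∈ as →
                   follow as bs x ≡ x'
  follow-correct {x} {x'} {a ∷ as} {b ∷ bs} (same ∷ sames) x∈ with x ≟ a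
  ... | yes x≡a = trans (cong (if_then b else follow as bs x) (dec-true (x ≟ a) x≡a))
                        (sym (≡ᵇ⇒≡ x' b (subst T same (≡⇒≡ᵇ x a x≡a))))
  ... | no  x≢a = trans (cong (if_then b else follow as bs x) (dec-false (x ≟ a) x≢a))
                        (follow-correct sames (Any.tail x≢a x∈))

  eqPattern≡⇒map-follow : ∀ {L L'} → eqPattern L ≡ eqPattern L' → map (follow L L') L ≡ L'
  eqPattern≡⇒map-follow {L} {L'} e = go (λ x∈ → x∈) (Pointwise.map⁻ _ _ (≡⇒Pointwise-≡ e))
    where
    go : ∀ {xs xs'} → (∀ {x} → x ∈ xs → x ∈ L) →
         Pointwise (λ x x' → map (x ≡ᵇ_) L ≡ map (x' ≡ᵇ_) L') xs xs' → map (follow L L') xs ≡ xs'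
    go _   []             = refl
    go sub (same ∷ sames) = cong₂ _∷_ (follow-correct (Pointwise.map⁻ _ _ (≡⇒Pointwise-≡ same)) (sub (here refl)))
                                      (go (sub ∘ there) sames)

  ++-injective : ∀ {a} {A : Set a} {xs ys xs' ys' : List A} → length xs ≡ length ys →
                 xs ++ xs' ≡ ys ++ ys' → xs ≡ ys × xs' ≡ ys'
  ++-injective {xs = []}     {[]}     _ e = refl , e
  ++-injective {xs = x ∷ xs} {y ∷ ys} l e =
    Product.map₁ (cong₂ _∷_ (∷-injectiveˡ e)) (++-injective (cong ℕ.pred l) (∷-injectiveʳ e))

  labels-injective : ∀ {π ρ} → order π ≡ order ρ → labels π ≡ labels ρ → π ≡ ρ
  labels-injective {π} {ρ} l e =
    let tops , bottoms = ++-injective (trans (length-map proj₁ π) (trans l (sym (length-map proj₁ ρ)))) e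
    in columns tops bottoms
    where
    columns : ∀ {π ρ : Diag} → map proj₁ π ≡ map proj₁ ρ → map proj₂ π ≡ map proj₂ ρ → π ≡ ρ
    columns {[]}    {[]}    _  _  = refl
    columns {_ ∷ _} {_ ∷ _} e₁ e₂ =
      cong₂ _∷_ (cong₂ _,_ (∷-injectiveˡ e₁) (∷-injectiveˡ e₂)) (columns (∷-injectiveʳ e₁) (∷-injectiveʳ e₂))

  Relabelling : Diag → Diag → Set
  Relabelling π ρ = ∃[ f ] relabel f π ≡ ρ

  key≡⇒Relabelling : ∀ π ρ → key π ≡ key ρ → Relabelling π ρ
  key≡⇒Relabelling π ρ e =
    follow (labels π) (labels ρ) ,
    labels-injective {relabel _ π} (trans (length-map _ π) (cong proj₁ e))
                     (trans (labels-relabel π) (eqPattern≡⇒map-follow (cong proj₂ e)))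

  Relabellings⇒key≡ : ∀ {π ρ} → Relabelling π ρ → Relabelling ρ π → key π ≡ key ρ
  Relabellings⇒key≡ {π} (f , refl) (g , gfπ≡π) =
    sym (cong₂ _,_ (length-map _ π)
                   (trans (cong eqPattern (labels-relabel π)) (eqPattern-map {g = g} (relabel-leftInverse π gfπ≡π))))

  Relabelling-take : ∀ j {π ρ} → Relabelling π ρ → Relabelling (take j π) (take j ρ)
  Relabelling-take j {π} (f , refl) = f , sym (take-map j π)

  Relabelling-drop : ∀ j {π ρ} → Relabelling π ρ → Relabelling (drop j π) (drop j ρ)
  Relabelling-drop j {π} (f , refl) = f , sym (drop-map j π)

  -- The labels of π are at most M, those of the shifted copy of ρ exceed M.
  Relabelling-⊗ : ∀ {π π' ρ ρ'} → Relabelling π π' → Relabelling ρ ρ' → Relabelling (π ⊗D ρ) (π' ⊗D ρ')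
  Relabelling-⊗ {π} {ρ = ρ} (f , refl) (g , refl) =
    h , trans (map-++ _ π _) (cong₂ _++_ on-π on-ρ)
    where
    M  = maxLabel π
    M' = maxLabel (relabel f π)
    h : ℕ → ℕ
    h x = if x ≤ᵇ M then f x else suc M' + g (x ∸ suc M)
    h-low : ∀ {x} → x ≤ M → h x ≡ f x
    h-low {x} x≤M = cong (if_then f x else suc M' + g (x ∸ suc M)) (dec-true (x ≤? M) x≤M)
    h-high : ∀ y → h (suc M + y) ≡ suc M' + g y
    h-high y = trans (cong (if_then f (suc M + y) else suc M' + g (suc M + y ∸ suc M))
                           (dec-false (suc M + y ≤? M) λ le → 1+n≰n (≤-trans (m≤m+n (suc M) y) le)))
                     (cong (λ z → suc M' + g z) (m+n∸m≡n (suc M) y))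
    on-π : relabel h π ≡ relabel f π
    on-π = map-cong-local (All.tabulate λ p∈ →
             let p₁≤M , p₂≤M = column-≤-maxLabel p∈ in cong₂ _,_ (h-low p₁≤M) (h-low p₂≤M))
    on-ρ : relabel h (relabel (suc M +_) ρ) ≡ relabel (suc M' +_) (relabel g ρ)
    on-ρ = trans (relabel-∘ ρ) (trans (relabel-cong h-high ρ) (sym (relabel-∘ ρ)))

  key-cong : (Φ : Diag → Diag) → (∀ {π ρ} → Relabelling π ρ → Relabelling (Φ π) (Φ ρ)) →
             ∀ {π ρ} → key π ≡ key ρ → key (Φ π) ≡ key (Φ ρ)
  key-cong Φ Φ-relabel {π} {ρ} e =
    Relabellings⇒key≡ (Φ-relabel (key≡⇒Relabelling π ρ e)) (Φ-relabel (key≡⇒Relabelling ρ π (sym e)))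

  key-take : ∀ j {π ρ} → key π ≡ key ρ → key (take j π) ≡ key (take j ρ)
  key-take j = key-cong (take j) (Relabelling-take j)

  key-drop : ∀ j {π ρ} → key π ≡ key ρ → key (drop j π) ≡ key (drop j ρ)
  key-drop j = key-cong (drop j) (Relabelling-drop j)

  key-⊗ : ∀ {π π' ρ ρ'} → key π ≡ key π' → key ρ ≡ key ρ' → key (π ⊗D ρ) ≡ key (π' ⊗D ρ')
  key-⊗ {π} {π'} {ρ} {ρ'} e₁ e₂ =
    Relabellings⇒key≡ (Relabelling-⊗ (key≡⇒Relabelling π π' e₁) (key≡⇒Relabelling ρ ρ' e₂))
                      (Relabelling-⊗ (key≡⇒Relabelling π' π (sym e₁)) (key≡⇒Relabelling ρ' ρ (sym e₂)))

  Planar-key : ∀ π ρ → key π ≡ key ρ → Planar π → Planar ρ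
  Planar-key π ρ e =
    Planar-relabel (proj₂ (key≡⇒Relabelling π ρ e)) (proj₂ (key≡⇒Relabelling ρ π (sym e)))

  -- Factorisation into ⊗-irreducibles

  splitsAt-key : ∀ {π ρ} j → key π ≡ key ρ → splitsAt π j ≡ splitsAt ρ j
  splitsAt-key {π} {ρ} j e =
    cong₂ sameKey (key-⊗ {take j π} {take j ρ} {drop j π} {drop j ρ} (key-take j e) (key-drop j e)) e

  firstCut-key : ∀ {π ρ} js → key π ≡ key ρ → firstCut π js ≡ firstCut ρ js
  firstCut-key []       e = refl
  firstCut-key (j ∷ js) e = cong₂ (if_then just j else_) (splitsAt-key j e) (firstCut-key js e)

  firstInnerCut-key : ∀ {π ρ} → key π ≡ key ρ → firstCut π (innerCuts π) ≡ firstCut ρ (innerCuts ρ)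
  firstInnerCut-key {π} {ρ} e =
    trans (firstCut-key (innerCuts π) e) (cong (λ k → firstCut ρ (map suc (upTo (k ∸ 1)))) (cong proj₁ e))

  factorsF-key : ∀ n {π ρ} → key π ≡ key ρ → map key (factorsF n π) ≡ map key (factorsF n ρ)
  factorsF-key zero    e = refl
  factorsF-key (suc n) {[]}    {[]}    e = refl
  factorsF-key (suc n) {p ∷ π} {q ∷ ρ} e
    with firstCut (p ∷ π) (innerCuts (p ∷ π)) | firstCut (q ∷ ρ) (innerCuts (q ∷ ρ)) | firstInnerCut-key e
  ... | nothing | .nothing | refl = cong (_∷ []) e
  ... | just j  | .(just j) | refl = cong₂ _∷_ (key-take j e) (factorsF-key n (key-drop j {p ∷ π} {q ∷ ρ} e))

  factors-key : ∀ {π ρ} → key π ≡ key ρ → map key (factors π) ≡ map key (factors ρ)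
  factors-key {π} {ρ} e =
    trans (cong (λ n → map key (factorsF n π)) (cong proj₁ e)) (factorsF-key (order ρ) e)

  factorsF-planar : ∀ n {π} → Planar π → All Planar (factorsF n π)
  factorsF-planar zero              _      = []
  factorsF-planar (suc n) {[]}      _      = []
  factorsF-planar (suc n) {p ∷ π}   planar with firstCut (p ∷ π) (innerCuts (p ∷ π))
  ... | nothing = planar ∷ []
  ... | just j  = Planar-take⁺ j planar ∷ factorsF-planar n (Planar-drop⁺ j planar)

  factors-map-key : ∀ {a} {A : Set a} (φ : Key → A) {π ρ} → key π ≡ key ρ →
                    map (φ ∘ key) (factors π) ≡ map (φ ∘ key) (factors ρ)
  factors-map-key φ {π} {ρ} e =
    trans (map-∘ (factors π)) (trans (cong (map φ) (factors-key {π} {ρ} e)) (sym (map-∘ (factors ρ))))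

  factors-planar : ∀ {π} → Planar π → All Planar (factors π)
  factors-planar {π} = factorsF-planar (order π)

module Linear {c ℓ} (R : CommutativeRing c ℓ) where

  open import Function using (_∘_)
  open import Data.Bool using (Bool; true; false; if_then_else_)
  open import Data.Nat as ℕ using (suc; _≤_; z≤n; s≤s)
  open import Data.Nat.Properties using (≤-refl; ≤-trans; +-mono-≤; m≤n⇒m≤1+n)
  open import Data.Product using (proj₁; proj₂)
  open import Data.List using (List; []; _∷_; _++_; map; concatMap; foldr; length)
  open import Relation.Binary.PropositionalEquality as ≡ using (_≡_)
  open PlanarDiagrams using (key; ≈D?-refl; ≈D?⇒key≡; ≈D?-congˡ; ≈D?-congʳ)
  open CommutativeRing R
  open import Relation.Binary.Reasoning.Setoid setoid
  open import Algebra.Properties.CommutativeSemigroup +-commutativeSemigroup using (x∙yz≈y∙xz)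

  indicator : Bool → Carrier
  indicator b = if b then 1# else 0#

  module _ {X : Set} where

    coeffWhere : (X → Bool) → List (Carrier × X) → Carrier
    coeffWhere Q = foldr (λ t acc → if Q (proj₂ t) then proj₁ t + acc else acc) 0#

    eval : List (Carrier × X) → (X → Carrier) → Carrier
    eval z g = foldr (λ t acc → proj₁ t * g (proj₂ t) + acc) 0# z

    coeffWhere-++ : ∀ Q z w → coeffWhere Q (z ++ w) ≈ coeffWhere Q z + coeffWhere Q w
    coeffWhere-++ Q []      w = sym (+-identityˡ _)
    coeffWhere-++ Q (t ∷ z) w with Q (proj₂ t)
    ... | true  = trans (+-congˡ (coeffWhere-++ Q z w)) (sym (+-assoc _ _ _))
    ... | false = coeffWhere-++ Q z w

    coeffWhere-skip : ∀ Q t z → Q (proj₂ t) ≡ false → coeffWhere Q (t ∷ z) ≡ coeffWhere Q z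
    coeffWhere-skip Q t z Qt≡false = ≡.cong (if_then proj₁ t + coeffWhere Q z else coeffWhere Q z) Qt≡false

    coeffWhere-cong : ∀ {Q Q'} → (∀ x → Q x ≡ Q' x) → ∀ z → coeffWhere Q z ≡ coeffWhere Q' z
    coeffWhere-cong Q≗Q' []      = ≡.refl
    coeffWhere-cong Q≗Q' (t ∷ z) =
      ≡.cong₂ (λ b acc → if b then proj₁ t + acc else acc) (Q≗Q' (proj₂ t)) (coeffWhere-cong Q≗Q' z)

    coeffWhere≈eval : ∀ Q z → coeffWhere Q z ≈ eval z (indicator ∘ Q)
    coeffWhere≈eval Q []      = refl
    coeffWhere≈eval Q (t ∷ z) with Q (proj₂ t)
    ... | true  = +-cong (sym (*-identityʳ _)) (coeffWhere≈eval Q z)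
    ... | false = trans (sym (+-identityˡ _)) (+-cong (sym (zeroʳ _)) (coeffWhere≈eval Q z))

    eval-cong : ∀ z {g h} → (∀ x → g x ≈ h x) → eval z g ≈ eval z h
    eval-cong []      g≈h = refl
    eval-cong (t ∷ z) g≈h = +-cong (*-congˡ (g≈h (proj₂ t))) (eval-cong z g≈h)

  coeffWhere-scale : ∀ {X Y : Set} (Q : X → Bool) a (h : Y → X) w →
                     coeffWhere Q (map (λ t → (a * proj₁ t , h (proj₂ t))) w) ≈ a * coeffWhere (Q ∘ h) w
  coeffWhere-scale Q a h []      = sym (zeroʳ a)
  coeffWhere-scale Q a h (t ∷ w) with Q (h (proj₂ t))
  ... | true  = trans (+-congˡ (coeffWhere-scale Q a h w)) (sym (distribˡ a _ _))
  ... | false = coeffWhere-scale Q a h w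

  -- the common shape of mul, Δ and S on formal combinations
  coeffWhere-concatMap : ∀ {X Y Z : Set} (Q : Z → Bool) (Φ : X → List (Carrier × Y)) (f : X → Y → Z) z →
    coeffWhere Q (concatMap (λ s → map (λ t → (proj₁ s * proj₁ t , f (proj₂ s) (proj₂ t))) (Φ (proj₂ s))) z)
      ≈ eval z (λ x → coeffWhere (Q ∘ f x) (Φ x))
  coeffWhere-concatMap Q Φ f []      = refl
  coeffWhere-concatMap Q Φ f (s ∷ z) =
    trans (coeffWhere-++ Q (map _ (Φ (proj₂ s))) _)
          (+-cong (coeffWhere-scale Q (proj₁ s) (f (proj₂ s)) (Φ (proj₂ s))) (coeffWhere-concatMap Q Φ f z))

  -- coeffWhere (_≈D? σ) is ParSym.coeff _ σ, so x ≋ y says that x and y denote the same element.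
  _≋_ : (x y : List (Carrier × Diag)) → Set ℓ
  x ≋ y = ∀ σ → coeffWhere (_≈D? σ) x ≈ coeffWhere (_≈D? σ) y

  KeyInvariant : (Diag → Carrier) → Set ℓ
  KeyInvariant g = ∀ {π ρ} → key π ≡ key ρ → g π ≈ g ρ

  without : Diag → List (Carrier × Diag) → List (Carrier × Diag)
  without π []      = []
  without π (t ∷ z) = if proj₂ t ≈D? π then without π z else t ∷ without π z

  length-without : ∀ π z → length (without π z) ≤ length z
  length-without π []      = z≤n
  length-without π (t ∷ z) with proj₂ t ≈D? π
  ... | true  = m≤n⇒m≤1+n (length-without π z)
  ... | false = s≤s (length-without π z)

  length-without-head : ∀ t z → length (without (proj₂ t) (t ∷ z)) ≤ length z
  length-without-head t z rewrite ≈D?-refl (proj₂ t) = length-without (proj₂ t) z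

  coeff-without-same : ∀ π σ z → key σ ≡ key π → coeffWhere (_≈D? σ) (without π z) ≈ 0#
  coeff-without-same π σ []      _   = refl
  coeff-without-same π σ (t ∷ z) σ~π with proj₂ t ≈D? π in t≉π
  ... | true  = coeff-without-same π σ z σ~π
  ... | false = trans (reflexive (coeffWhere-skip (_≈D? σ) t (without π z) t≉σ)) (coeff-without-same π σ z σ~π)
    where
    t≉σ = ≡.trans (≈D?-congʳ (proj₂ t) σ π σ~π) t≉π

  coeff-without-other : ∀ π σ z → (π ≈D? σ) ≡ false →
                        coeffWhere (_≈D? σ) (without π z) ≈ coeffWhere (_≈D? σ) z
  coeff-without-other π σ []      _   = refl
  coeff-without-other π σ (t ∷ z) π≉σ with proj₂ t ≈D? π in t~π
  ... | true  = trans (coeff-without-other π σ z π≉σ) (sym (reflexive (coeffWhere-skip (_≈D? σ) t z t≉σ)))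
    where
    t≉σ = ≡.trans (≈D?-congˡ (proj₂ t) π σ (≈D?⇒key≡ (proj₂ t) π t~π)) π≉σ
  ... | false with proj₂ t ≈D? σ
  ...   | true  = +-congˡ (coeff-without-other π σ z π≉σ)
  ...   | false = coeff-without-other π σ z π≉σ

  without-resp : ∀ π x y → x ≋ y → without π x ≋ without π y
  without-resp π x y x≋y σ with π ≈D? σ in π~σ
  ... | true  = let σ~π = ≡.sym (≈D?⇒key≡ π σ π~σ) in
                trans (coeff-without-same π σ x σ~π) (sym (coeff-without-same π σ y σ~π))
  ... | false = trans (coeff-without-other π σ x π~σ) (trans (x≋y σ) (sym (coeff-without-other π σ y π~σ)))

  eval-split : ∀ {g} → KeyInvariant g → ∀ π z →
               eval z g ≈ coeffWhere (_≈D? π) z * g π + eval (without π z) g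
  eval-split {g} inv π []      = sym (trans (+-identityʳ _) (zeroˡ _))
  eval-split {g} inv π (t ∷ z) with proj₂ t ≈D? π in t~π
  ... | true  = begin
    proj₁ t * g (proj₂ t) + eval z g
      ≈⟨ +-cong (*-congˡ (inv (≈D?⇒key≡ (proj₂ t) π t~π))) (eval-split inv π z) ⟩
    proj₁ t * g π + (coeffWhere (_≈D? π) z * g π + eval (without π z) g)
      ≈⟨ sym (+-assoc _ _ _) ⟩
    (proj₁ t * g π + coeffWhere (_≈D? π) z * g π) + eval (without π z) g
      ≈⟨ +-congʳ (sym (distribʳ (g π) _ _)) ⟩
    (proj₁ t + coeffWhere (_≈D? π) z) * g π + eval (without π z) g ∎
  ... | false = trans (+-congˡ (eval-split inv π z)) (x∙yz≈y∙xz _ _ _)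

  -- Both sides split off the ≈D-class of a common term, on which they have the same coefficient.
  eval-resp : ∀ {g} → KeyInvariant g → ∀ x y → x ≋ y → eval x g ≈ eval y g
  eval-resp {g} inv x y = go (length x ℕ.+ length y) x y ≤-refl
    where
    step : ∀ π x y → x ≋ y → eval (without π x) g ≈ eval (without π y) g → eval x g ≈ eval y g
    step π x y x≋y ih = begin
      eval x g                                           ≈⟨ eval-split inv π x ⟩
      coeffWhere (_≈D? π) x * g π + eval (without π x) g ≈⟨ +-cong (*-congʳ (x≋y π)) ih ⟩
      coeffWhere (_≈D? π) y * g π + eval (without π y) g ≈⟨ sym (eval-split inv π y) ⟩
      eval y g                                           ∎
    go : ∀ n x y → length x ℕ.+ length y ≤ n → x ≋ y → eval x g ≈ eval y g
    go _       []      []      _         _   = refl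
    go (suc n) (t ∷ x) y       (s≤s len) x≋y =
      step (proj₂ t) (t ∷ x) y x≋y
        (go n (without (proj₂ t) (t ∷ x)) (without (proj₂ t) y)
            (≤-trans (+-mono-≤ (length-without-head t x) (length-without (proj₂ t) y)) len)
            (without-resp (proj₂ t) (t ∷ x) y x≋y))
    go (suc n) []      (t ∷ y) (s≤s len) x≋y =
      step (proj₂ t) [] (t ∷ y) x≋y
        (go n [] (without (proj₂ t) (t ∷ y)) (≤-trans (length-without-head t y) len)
            (without-resp (proj₂ t) [] (t ∷ y) x≋y))

  coeffWhere-resp : ∀ {Q} → (∀ {π ρ} → key π ≡ key ρ → Q π ≡ Q ρ) →
                    ∀ x y → x ≋ y → coeffWhere Q x ≈ coeffWhere Q y
  coeffWhere-resp {Q} inv x y x≋y = begin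
    coeffWhere Q x         ≈⟨ coeffWhere≈eval Q x ⟩
    eval x (indicator ∘ Q) ≈⟨ eval-resp (λ {π} {ρ} e → reflexive (≡.cong indicator (inv {π} {ρ} e))) x y x≋y ⟩
    eval y (indicator ∘ Q) ≈⟨ sym (coeffWhere≈eval Q y) ⟩
    coeffWhere Q y         ∎

  extension-resp : ∀ {Y : Set} (Φ : Diag → List (Carrier × Y)) → (∀ {π ρ} → key π ≡ key ρ → Φ π ≡ Φ ρ) →
    ∀ Q x y → x ≋ y →
    coeffWhere Q (concatMap (λ t → map (λ u → (proj₁ t * proj₁ u , proj₂ u)) (Φ (proj₂ t))) x) ≈
    coeffWhere Q (concatMap (λ t → map (λ u → (proj₁ t * proj₁ u , proj₂ u)) (Φ (proj₂ t))) y)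
  extension-resp Φ inv Q x y x≋y = begin
    _                                 ≈⟨ coeffWhere-concatMap Q Φ (λ _ u → u) x ⟩
    eval x (λ π → coeffWhere Q (Φ π)) ≈⟨ eval-resp (λ {π} {ρ} e → reflexive (≡.cong (coeffWhere Q) (inv {π} {ρ} e)))
                                                   x y x≋y ⟩
    eval y (λ π → coeffWhere Q (Φ π)) ≈⟨ sym (coeffWhere-concatMap Q Φ (λ _ u → u) y) ⟩
    _                                 ∎

module PlanarSpan {c ℓ} (F : Field c ℓ) where

  open import Function using (_∘_)
  open import Data.Bool using (Bool; true; false; _∧_; if_then_else_)
  open import Data.Bool.Properties using (∧-conicalʳ)
  open import Data.Nat using (suc; _∸_)
  open import Data.Product using (_,_; proj₁; proj₂)
  open import Data.List using (List; []; _∷_; reverse; concatMap; length; upTo)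
  open import Data.List.Relation.Unary.All using (All; []; _∷_)
  import Data.List.Relation.Unary.All as All
  import Data.List.Relation.Unary.All.Properties as All
  import Data.List.Relation.Unary.Any.Properties as Any
  open import Relation.Binary.PropositionalEquality as ≡ using (_≡_)
  open PlanarDiagrams
  open Field F
  open ParSym F
  open Linear commutativeRing
  open import Relation.Binary.Reasoning.Setoid setoid

  All-concatMap⁺ : ∀ {a b p} {A : Set a} {B : Set b} {P : B → Set p} (f : A → List B) xs →
                   All (All P ∘ f) xs → All P (concatMap f xs)
  All-concatMap⁺ f xs = All.concat⁺ ∘ All.map⁺

  All-reverse⁺ : ∀ {a p} {A : Set a} {P : A → Set p} {xs} → All P xs → All P (reverse xs)
  All-reverse⁺ ps = All.tabulate (All.lookup ps ∘ Any.reverse⁻)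

  PlanarTerms : Elt → Set c
  PlanarTerms = All (Planar ∘ proj₂)

  PlanarTerms₂ : Elt2 → Set c
  PlanarTerms₂ = All (λ t → Planar (proj₁ (proj₂ t)) × Planar (proj₂ (proj₂ t)))

  mul-planar : ∀ x y → PlanarTerms x → PlanarTerms y → PlanarTerms (mul x y)
  mul-planar x y px py =
    All-concatMap⁺ _ x (All.map (λ {s} ps → All.map⁺ (All.map (λ {t} → Planar-⊗⁺ (proj₂ s) (proj₂ t) ps) py)) px)

  mul2-planar : ∀ x y → PlanarTerms₂ x → PlanarTerms₂ y → PlanarTerms₂ (mul2 x y)
  mul2-planar x y px py =
    All-concatMap⁺ _ x (All.map (λ {s} ps → All.map⁺ (All.map (λ {t} pt →
      Planar-⊗⁺ (proj₁ (proj₂ s)) (proj₁ (proj₂ t)) (proj₁ ps) (proj₁ pt) ,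
      Planar-⊗⁺ (proj₂ (proj₂ s)) (proj₂ (proj₂ t)) (proj₂ ps) (proj₂ pt)) py)) px)

  prodL-planar : ∀ xs → All PlanarTerms xs → PlanarTerms (prodL xs)
  prodL-planar []       []         = Planar-∅ ∷ []
  prodL-planar (x ∷ xs) (px ∷ pxs) = mul-planar x (prodL xs) px (prodL-planar xs pxs)

  prodL2-planar : ∀ xs → All PlanarTerms₂ xs → PlanarTerms₂ (prodL2 xs)
  prodL2-planar []       []         = (Planar-∅ , Planar-∅) ∷ []
  prodL2-planar (x ∷ xs) (px ∷ pxs) = mul2-planar x (prodL2 xs) px (prodL2-planar xs pxs)

  ΔIrr-planar : ∀ π → Planar π → PlanarTerms₂ (ΔIrr π)
  ΔIrr-planar π planar =
    All-concatMap⁺ _ (upTo (suc (order π))) (All.universal (λ a →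
      All-concatMap⁺ _ (diagrams a) (All.universal (λ G₁ →
        All-concatMap⁺ _ (diagrams (order π ∸ a)) (All.universal (term G₁) _)) _)) _)
    where
    term : ∀ G₁ G₂ → PlanarTerms₂ (if okG G₁ ∧ okG G₂ ∧ ((G₁ •D G₂) ≈D? π) then (1# , G₁ , G₂) ∷ [] else [])
    term G₁ G₂ with okG G₁ ∧ okG G₂ ∧ ((G₁ •D G₂) ≈D? π) in selected
    ... | true  = Planar-•⁻ G₁ G₂ (Planar-key π (G₁ •D G₂) (≡.sym (≈D?⇒key≡ (G₁ •D G₂) π G₁•G₂~π)) planar) ∷ []
      where G₁•G₂~π = ∧-conicalʳ (okG G₂) _ (∧-conicalʳ (okG G₁) _ selected)
    ... | false = []

  SIrr-planar : ∀ π → Planar π → PlanarTerms (SIrr π)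
  SIrr-planar π planar =
    All-concatMap⁺ _ (compositions (order π)) (All.universal (λ comp →
      All-concatMap⁺ _ (tuples comp) (All.universal (term comp) _)) _)
    where
    term : ∀ comp ρs → PlanarTerms (if bullets ρs ≈D? π then (sign (length comp) , tensors ρs) ∷ [] else [])
    term comp ρs with bullets ρs ≈D? π in selected
    ... | true  = Planar-tensors⁺ ρs (Planar-bullets⁻ ρs (Planar-key π (bullets ρs)
                    (≡.sym (≈D?⇒key≡ (bullets ρs) π selected)) planar)) ∷ []
    ... | false = []

  ΔH-planar : ∀ π → Planar π → PlanarTerms₂ (ΔH π)
  ΔH-planar π planar =
    prodL2-planar _ (All.map⁺ (All.map (λ {ρ} → ΔIrr-planar ρ) (factors-planar {π} planar)))

  SH-planar : ∀ π → Planar π → PlanarTerms (SH π)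
  SH-planar π planar =
    prodL-planar _ (All-reverse⁺ (All.map⁺ (All.map (λ {ρ} → SIrr-planar ρ) (factors-planar {π} planar))))

  Δ-planar : ∀ x → PlanarTerms x → PlanarTerms₂ (Δ x)
  Δ-planar x px = All-concatMap⁺ _ x (All.map (λ {t} pt → All.map⁺ (ΔH-planar (proj₂ t) pt)) px)

  S-planar : ∀ x → PlanarTerms x → PlanarTerms (S x)
  S-planar x px = All-concatMap⁺ _ x (All.map (λ {t} pt → All.map⁺ (SH-planar (proj₂ t) pt)) px)

  -- ΔIrr π is ΔIrrᵏ (key π) and SIrr π is SIrrᵏ (key π), by definition.
  ΔIrrᵏ : Key → Elt2
  ΔIrrᵏ K = concatMap (λ a → concatMap (λ G₁ → concatMap (λ G₂ →
              if okG G₁ ∧ okG G₂ ∧ sameKey (key (G₁ •D G₂)) K then (1# , G₁ , G₂) ∷ [] else [])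
            (diagrams (proj₁ K ∸ a))) (diagrams a)) (upTo (suc (proj₁ K)))

  SIrrᵏ : Key → Elt
  SIrrᵏ K = concatMap (λ comp → concatMap (λ ρs →
              if sameKey (key (bullets ρs)) K then (sign (length comp) , tensors ρs) ∷ [] else [])
            (tuples comp)) (compositions (proj₁ K))

  ΔH-key : ∀ {π ρ} → key π ≡ key ρ → ΔH π ≡ ΔH ρ
  ΔH-key {π} {ρ} e = ≡.cong prodL2 (factors-map-key ΔIrrᵏ {π} {ρ} e)

  SH-key : ∀ {π ρ} → key π ≡ key ρ → SH π ≡ SH ρ
  SH-key {π} {ρ} e = ≡.cong (prodL ∘ reverse) (factors-map-key SIrrᵏ {π} {ρ} e)

  mul-resp : ∀ x x' y y' → x ≋ x' → y ≋ y' → mul x y ≋ mul x' y'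
  mul-resp x x' y y' x≋x' y≋y' σ = begin
    coeff (mul x y) σ                        ≈⟨ coeffWhere-concatMap (_≈D? σ) (λ _ → y) _⊗D_ x ⟩
    eval x (λ π → coeffWhere (factor π) y)   ≈⟨ eval-resp (λ {π} {π'} e → reflexive (coeffWhere-cong (λ ρ →
                                                   factor-key {π} {π'} {ρ} {ρ} e ≡.refl) y)) x x' x≋x' ⟩
    eval x' (λ π → coeffWhere (factor π) y)  ≈⟨ eval-cong x' (λ π → coeffWhere-resp (λ {ρ} {ρ'} →
                                                   factor-key {π} {π} {ρ} {ρ'} ≡.refl) y y' y≋y') ⟩
    eval x' (λ π → coeffWhere (factor π) y') ≈⟨ sym (coeffWhere-concatMap (_≈D? σ) (λ _ → y') _⊗D_ x') ⟩
    coeff (mul x' y') σ                      ∎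
    where
    factor : Diag → Diag → Bool
    factor π ρ = (π ⊗D ρ) ≈D? σ
    factor-key : ∀ {π π' ρ ρ'} → key π ≡ key π' → key ρ ≡ key ρ' → factor π ρ ≡ factor π' ρ'
    factor-key {π} {π'} {ρ} {ρ'} e₁ e₂ = ≈D?-congˡ (π ⊗D ρ) (π' ⊗D ρ') σ (key-⊗ {π} {π'} {ρ} {ρ'} e₁ e₂)

  Δ-resp : ∀ x y → x ≋ y → ∀ σ τ → coeff2 (Δ x) σ τ ≈ coeff2 (Δ y) σ τ
  Δ-resp x y x≋y σ τ =
    extension-resp ΔH (λ {π} {ρ} → ΔH-key {π} {ρ}) (λ d → (proj₁ d ≈D? σ) ∧ (proj₂ d ≈D? τ)) x y x≋y

  S-resp : ∀ x y → x ≋ y → S x ≋ S y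
  S-resp x y x≋y σ = extension-resp SH (λ {π} {ρ} → SH-key {π} {ρ}) (_≈D? σ) x y x≋y

  InPlanarSpan-one : InPlanarSpan one
  InPlanarSpan-one = one , Planar-∅ ∷ [] , λ _ → refl

  InPlanarSpan-mul : ∀ x y → InPlanarSpan x → InPlanarSpan y → InPlanarSpan (mul x y)
  InPlanarSpan-mul x y (x₀ , px₀ , x≋x₀) (y₀ , py₀ , y≋y₀) =
    mul x₀ y₀ , mul-planar x₀ y₀ px₀ py₀ , mul-resp x x₀ y y₀ x≋x₀ y≋y₀

  InPlanarSpan-Δ : ∀ x → InPlanarSpan x → InPlanarSpan2 (Δ x)
  InPlanarSpan-Δ x (x₀ , px₀ , x≋x₀) = Δ x₀ , Δ-planar x₀ px₀ , Δ-resp x x₀ x≋x₀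

  InPlanarSpan-S : ∀ x → InPlanarSpan x → InPlanarSpan (S x)
  InPlanarSpan-S x (x₀ , px₀ , x≋x₀) = S x₀ , S-planar x₀ px₀ , S-resp x x₀ x≋x₀

theorem4p1 : ∀ {c ℓ : Level} (F : Field c ℓ) → let open ParSym F in
    InPlanarSpan one
    × (∀ x y → InPlanarSpan x → InPlanarSpan y → InPlanarSpan (mul x y))
    × (∀ x → InPlanarSpan x → InPlanarSpan2 (Δ x))
    × (∀ x → InPlanarSpan x → InPlanarSpan (S x))
theorem4p1 F = InPlanarSpan-one , InPlanarSpan-mul , InPlanarSpan-Δ , InPlanarSpan-S
  where open PlanarSpan F
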